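{- Let $\preceq$ be an entrenchment relation satisfying Weak Left Disjunction. Then: (1) for all $\alpha,\beta\in\mathcal{L}$, $\neg\alpha\lor\neg\beta\preceq\neg\alpha$ if and only if $\alpha\mathrel{|\!\sim^w_\preceq}\beta$; (2) if $\preceq$ satisfies, in addition, Transitivity and Right Conjunction, then for all $\alpha,\beta$, $\neg\alpha\lor\neg\beta\preceq\neg\alpha$ implies $\alpha\mathrel{|\!\sim_\preceq}\beta$.
   Context: $\mathcal{L}$ is the set of formulas of a propositional language closed under $\lor,\land,\neg,\to$. $\vdash\subseteq 2^{\mathcal{L}}\times\mathcal{L}$ is a fixed consequence relation including classical propositional logic, compact, satisfying the deduction theorem and disjunction in premises; $\alpha\vdash\beta$ means $\{\alpha\}\vdash\beta$; $\mathrm{Cn}(X)=\{\beta:X\vdash\beta\}$, $\mathrm{Cn}(X,\alpha)=\mathrm{Cn}(X\cup\{\alpha\})$. An entrenchment relation is a binary relation $\preceq$ on $\mathcal{L}$ such that for all $\alpha,\beta,\gamma$: $\alpha\preceq\alpha$; $\alpha\vdash\beta$ and $\beta\preceq\gamma$ imply $\alpha\preceq\gamma$; if $\alpha\vdash\beta$ and $\beta\vdash\alpha$ then $\gamma\preceq\alpha$ iff $\gamma\preceq\beta$. Properties (for all formulas): Weak Left Disjunction: $\alpha\lor\beta\preceq\alpha$ and $\alpha\lor\gamma\preceq\alpha$ imply $\alpha\lor\beta\lor\gamma\preceq\alpha$. Transitivity: $\alpha\preceq\beta$ and $\beta\preceq\gamma$ imply $\alpha\preceq\gamma$. Right Conjunction: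 $\gamma\preceq\alpha$ and $\gamma\preceq\beta$ imply $\gamma\preceq\alpha\land\beta$. $\mathrm{Coh}(\alpha)=\{\beta:\beta\not\preceq\neg\alpha\}$. Maxiconsistent inference: $\mathcal{B}(\alpha)$ = deductively closed $U$ with $U\subseteq\mathrm{Coh}(\alpha)$; $\mathcal{B}_{\max}(\alpha)$ = those $U\in\mathcal{B}(\alpha)$ with no deductively closed $U'\supsetneq U$ in $\mathcal{B}(\alpha)$; $E(\alpha)=\bigcap\{\mathrm{Cn}(U,\alpha):U\in\mathcal{B}_{\max}(\alpha)\}$; $\alpha\mathrel{|\!\sim_\preceq}\beta$ iff $\beta\in E(\alpha)$. Weak maxiconsistent inference: $U^\alpha=\{\alpha\to\beta:\beta\in U\}$; $\mathcal{B}^w(\alpha)$ = deductively closed $U$ with $U^\alpha\subseteq\mathrm{Coh}(\alpha)$; $\mathcal{B}^w_{\max}(\alpha)$ = those $U\in\mathcal{B}^w(\alpha)$ such that no deductively closed $V\in\mathcal{B}^w(\alpha)$ has $U^\alpha\subsetneq V^\alpha$; $E^w(\alpha)=\bigcap\mathcal{B}^w_{\max}(\alpha)$; $\alpha\mathrel{|\!\sim^w_\preceq}\beta$ iff $\beta\in E^w(\alpha)$. Intersections of empty families are $\mathcal{L}$. -}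

module Defs where

open import Data.Bool using (Bool; true; false; _∧_; _∨_; not)
open import Data.Product using (Σ; ∃; _×_; _,_)
open import Data.Sum using (_⊎_)
open import Data.Empty using (⊥)
open import Data.List using (List)
open import Data.List.Membership.Propositional using (_∈_)
open import Relation.Nullary using (¬_)
open import Relation.Binary.PropositionalEquality using (_≡_)

data Form (Atom : Set) : Set where
  atom : Atom → Form Atom
  _∨'_ _∧'_ _⇒_ : Form Atom → Form Atom → Form Atom
  ¬'_ : Form Atom → Form Atom

infixr 6 _∧'_
infixr 5 _∨'_
infixr 4 _⇒_
infix 7 ¬'_

module _ {Atom : Set} where

  FSet : Set₁
  FSet = Form Atom → Set

  _⊆_ : FSet → FSet → Set
  X ⊆ Y = ∀ φ → X φ → Y φ

  ⟦_⟧ : Form Atom → FSet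
  ⟦ α ⟧ φ = φ ≡ α

  _∪⟦_⟧ : FSet → Form Atom → FSet
  (X ∪⟦ α ⟧) φ = X φ ⊎ φ ≡ α

  _∪_ : FSet → FSet → FSet
  (X ∪ Y) φ = X φ ⊎ Y φ

  listSet : List (Form Atom) → FSet
  listSet xs φ = φ ∈ xs

  eval : (Atom → Bool) → Form Atom → Bool
  eval v (atom a) = v a
  eval v (φ ∨' ψ) = eval v φ ∨ eval v ψ
  eval v (φ ∧' ψ) = eval v φ ∧ eval v ψ
  eval v (φ ⇒ ψ) = not (eval v φ) ∨ eval v ψ
  eval v (¬' φ) = not (eval v φ)

  _⊨_ : FSet → Form Atom → Set
  X ⊨ φ = ∀ (v : Atom → Bool) → (∀ ψ → X ψ → eval v ψ ≡ true) → eval v φ ≡ true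

  record ConsRel : Set₁ where
    field
      _⊢_ : FSet → Form Atom → Set
      inclusion   : ∀ X φ → X φ → X ⊢ φ
      monotony    : ∀ X Y φ → X ⊆ Y → X ⊢ φ → Y ⊢ φ
      cut         : ∀ X Y φ → (∀ ψ → Y ψ → X ⊢ ψ) → (X ∪ Y) ⊢ φ → X ⊢ φ
      supraclassical : ∀ X φ → X ⊨ φ → X ⊢ φ
      compact     : ∀ X φ → X ⊢ φ →
                    Σ (List (Form Atom)) λ xs → (listSet xs ⊆ X) × (listSet xs ⊢ φ)
      deduction   : ∀ X α β → (X ∪⟦ α ⟧) ⊢ β → X ⊢ (α ⇒ β)
      deduction⁻  : ∀ X α β → X ⊢ (α ⇒ β) → (X ∪⟦ α ⟧) ⊢ β
      disjPrem    : ∀ X α β γ → (X ∪⟦ α ⟧) ⊢ γ → (X ∪⟦ β ⟧) ⊢ γ →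
                    (X ∪⟦ α ∨' β ⟧) ⊢ γ

  module _ (C : ConsRel) where
    open ConsRel C

    _⊢₁_ : Form Atom → Form Atom → Set
    α ⊢₁ β = ⟦ α ⟧ ⊢ β

    Closed : FSet → Set
    Closed U = ∀ φ → U ⊢ φ → U φ

    module _ (_≼_ : Form Atom → Form Atom → Set) where

      record IsEntrenchment : Set where
        field
          refl≼ : ∀ α → α ≼ α
          dominance : ∀ α β γ → α ⊢₁ β → β ≼ γ → α ≼ γ
          rightEquiv : ∀ α β γ → α ⊢₁ β → β ⊢₁ α → (γ ≼ α → γ ≼ β) × (γ ≼ β → γ ≼ α)

      WeakLeftDisjunction : Set
      WeakLeftDisjunction = ∀ α β γ →
        (α ∨' β) ≼ α → (α ∨' γ) ≼ α → (α ∨' β ∨' γ) ≼ α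

      Transitivity : Set
      Transitivity = ∀ α β γ → α ≼ β → β ≼ γ → α ≼ γ

      RightConjunction : Set
      RightConjunction = ∀ α β γ → γ ≼ α → γ ≼ β → γ ≼ (α ∧' β)

      Coh : Form Atom → FSet
      Coh α β = ¬ (β ≼ (¬' α))

      𝓑 : Form Atom → FSet → Set
      𝓑 α U = Closed U × (U ⊆ Coh α)

      𝓑max : Form Atom → FSet → Set₁
      𝓑max α U = 𝓑 α U × (∀ U' → 𝓑 α U' → U ⊆ U' → ¬ (∃ λ φ → U' φ × ¬ U φ))

      _|~_ : Form Atom → Form Atom → Set₁
      α |~ β = ∀ U → 𝓑max α U → (U ∪⟦ α ⟧) ⊢ β

      _^_ : FSet → Form Atom → FSet
      (U ^ α) φ = ∃ λ β → U β × (φ ≡ (α ⇒ β))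

      𝓑w : Form Atom → FSet → Set
      𝓑w α U = Closed U × ((U ^ α) ⊆ Coh α)

      𝓑wmax : Form Atom → FSet → Set₁
      𝓑wmax α U = 𝓑w α U ×
        (∀ V → 𝓑w α V → (U ^ α) ⊆ (V ^ α) → ¬ (∃ λ φ → (V ^ α) φ × ¬ (U ^ α) φ))

      _|~w_ : Form Atom → Form Atom → Set₁
      α |~w β = ∀ U → 𝓑wmax α U → U β

-- Write I(γ) for (α ⇒ γ) ≼ ¬α, so that 𝓑w(α) consists of the closed sets disjoint from I and
-- ¬α ∨ ¬β ≼ ¬α amounts to I(¬β). Weak Left Disjunction makes I an ideal of the Lindenbaum
-- algebra: downward closed and closed under ∨.
-- If I(¬β), then Cn(U ∪ {β}) is still disjoint from I for U ∈ 𝓑w_max(α), because I(γ) gives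
-- I(¬β ∨ γ), that is I(β ⇒ γ); so β ∈ U by maximality.
-- Conversely, a valuation satisfying all theorems and all ¬γ with I(γ) has a complete theory,
-- which is maximal in 𝓑w(α), so by hypothesis β follows from these premises. By compactness,
-- finitely many suffice, and then ¬β entails a finite disjunction of members of I, so I(¬β).
-- For (2), Transitivity and Right Conjunction show that I(¬β) and δ ≼ ¬α give
-- ((α ⇒ β) ⇒ δ) ≼ ¬α, so Cn(U ∪ {α ⇒ β}) stays in 𝓑(α) and α ⇒ β ∈ U for U ∈ 𝓑_max(α).

module Submission where

open import Defs
open import Data.Bool using (Bool; true; false; not; _∨_; _∧_; _≟_)
open import Data.Bool.Properties using (¬-not)
open import Data.Fin using (Fin; zero; suc)
open import Data.Fin.Subset.Properties using (anySubset?)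
open import Data.List using ([]; _∷_)
open import Data.List.Relation.Unary.Any using (here; there)
open import Data.Nat using (ℕ; suc)
open import Data.Product using (_×_; _,_; ∃; proj₁)
open import Data.Sum using (_⊎_; inj₁; inj₂)
open import Data.Vec using (Vec; []; _∷_; lookup; map)
open import Data.Vec.Properties using (lookup-map)
open import Function using (_∘_; id)
open import Relation.Nullary using (¬_; contradiction)
open import Relation.Nullary.Decidable using (False; toWitnessFalse; decidable-stable)
open import Relation.Binary.PropositionalEquality using (_≡_; refl; sym; trans; cong; cong₂)

private variable
  A : Set
  n : ℕ

Schema : ℕ → Set
Schema n = Form (Fin n)

p₀ : Schema (suc n)
p₀ = atom zero

p₁ : Schema (suc (suc n))
p₁ = atom (suc zero)

p₂ : Schema (suc (suc (suc n)))
p₂ = atom (suc (suc zero))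

infix 25 _[_]

_[_] : Schema n → Vec (Form A) n → Form A
atom i [ σ ] = lookup σ i
(φ ∨' ψ) [ σ ] = φ [ σ ] ∨' ψ [ σ ]
(φ ∧' ψ) [ σ ] = φ [ σ ] ∧' ψ [ σ ]
(φ ⇒ ψ) [ σ ] = φ [ σ ] ⇒ ψ [ σ ]
(¬' φ) [ σ ] = ¬' φ [ σ ]

eval-[] : ∀ v (σ : Vec (Form A) n) φ → eval v (φ [ σ ]) ≡ eval (lookup (map (eval v) σ)) φ
eval-[] v σ (atom i) = sym (lookup-map i (eval v) σ)
eval-[] v σ (φ ∨' ψ) = cong₂ _∨_ (eval-[] v σ φ) (eval-[] v σ ψ)
eval-[] v σ (φ ∧' ψ) = cong₂ _∧_ (eval-[] v σ φ) (eval-[] v σ ψ)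
eval-[] v σ (φ ⇒ ψ) = cong₂ (_∨_ ∘ not) (eval-[] v σ φ) (eval-[] v σ ψ)
eval-[] v σ (¬' φ) = cong not (eval-[] v σ φ)

-- A truth table search over valuations Subset n = Vec Bool n. For a concrete schema it reduces
-- to ⊤, so an implicit argument of this type is filled in by the type checker.
Tautology : Schema n → Set
Tautology φ = False (anySubset? λ s → eval (lookup s) φ ≟ false)

tautology-valid : ∀ {φ : Schema n} → Tautology φ →
                  ∀ (σ : Vec (Form A) n) v → eval v (φ [ σ ]) ≡ true
tautology-valid {φ = φ} t σ v =
  trans (eval-[] v σ φ) (¬-not λ refuted → toWitnessFalse t (map (eval v) σ , refuted))

modus-ponens : ∀ {a b} → (not a ∨ b) ≡ true → a ≡ true → b ≡ true
modus-ponens a⇒b refl = a⇒b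

Truths : (A → Bool) → FSet {A}
Truths v φ = eval v φ ≡ true

truths-complete : ∀ (v : A → Bool) γ → Truths v γ ⊎ Truths v (¬' γ)
truths-complete v γ with eval v γ
... | true = inj₁ refl
... | false = inj₂ refl

truths-consistent : ∀ (v : A → Bool) γ → Truths v γ → ¬ Truths v (¬' γ)
truths-consistent v γ γ-true ¬γ-true = contradiction (trans (sym ¬γ-true) (cong not γ-true)) λ ()

module Consequence {A : Set} (C : ConsRel {A}) where
  open ConsRel C

  private variable
    X U : FSet {A}
    φ ψ x y : Form A

  ∅ : FSet {A}
  ∅ = listSet []

  Cn : FSet {A} → FSet {A}
  Cn X = X ⊢_

  Cn-closed : Closed C (Cn X)
  Cn-closed {X} φ d = cut X (Cn X) φ (λ _ → id) (monotony (Cn X) (X ∪ Cn X) φ (λ _ → inj₂) d)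

  theorem : ∅ ⊢ φ → X ⊢ φ
  theorem {X = X} = monotony ∅ X _ λ _ ()

  ⊢-trans : X ⊢ φ → ⟦ φ ⟧ ⊢ ψ → X ⊢ ψ
  ⊢-trans {X} {φ} {ψ} X⊢φ φ⊢ψ =
    cut X ⟦ φ ⟧ ψ (λ { _ refl → X⊢φ }) (monotony ⟦ φ ⟧ (X ∪ ⟦ φ ⟧) ψ (λ _ → inj₂) φ⊢ψ)

  taut⊢ : (σ : Vec (Form A) n) (P R : Schema n) → {Tautology (P ⇒ R)} → ⟦ P [ σ ] ⟧ ⊢ R [ σ ]
  taut⊢ σ P R {t} = supraclassical _ _ λ v ⊨P →
    modus-ponens (tautology-valid {φ = P ⇒ R} t σ v) (⊨P _ refl)

  ⊢-taut₂ : (σ : Vec (Form A) n) (P Q R : Schema n) → {Tautology (P ⇒ Q ⇒ R)} →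
            X ⊢ P [ σ ] → X ⊢ Q [ σ ] → X ⊢ R [ σ ]
  ⊢-taut₂ {X = X} σ P Q R {t} X⊢P X⊢Q =
    cut X (⟦ P [ σ ] ⟧ ∪ ⟦ Q [ σ ] ⟧) _ (λ { _ (inj₁ refl) → X⊢P ; _ (inj₂ refl) → X⊢Q })
      (supraclassical _ _ λ v ⊨PQ →
        modus-ponens (modus-ponens (tautology-valid {φ = P ⇒ Q ⇒ R} t σ v)
                                   (⊨PQ _ (inj₂ (inj₁ refl))))
                     (⊨PQ _ (inj₂ (inj₂ refl))))

  closed-stable : Closed C U → ¬ ¬ U φ → U φ
  closed-stable {U} {φ} clU ¬¬φ = clU φ (supraclassical U φ λ v ⊨U →
    decidable-stable (eval v φ ≟ true) λ φ-false → ¬¬φ (φ-false ∘ ⊨U φ))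

  deduction-∷ : ∀ {ys} → listSet (y ∷ ys) ⊢ φ → listSet ys ⊢ (y ⇒ φ)
  deduction-∷ {y} {φ} {ys} d = deduction (listSet ys) y φ
    (monotony _ _ φ (λ { _ (here refl) → inj₂ refl ; _ (there m) → inj₁ m }) d)

  ⇒-monotone : ∀ {α} → ⟦ x ⟧ ⊢ y → ⟦ α ⇒ x ⟧ ⊢ (α ⇒ y)
  ⇒-monotone {x} {y} {α} x⊢y = deduction ⟦ α ⇒ x ⟧ α y (⊢-trans
    (⊢-taut₂ (α ∷ x ∷ []) (p₀ ⇒ p₁) p₀ p₁ (inclusion _ _ (inj₁ refl)) (inclusion _ _ (inj₂ refl)))
    x⊢y)

  truths-closed : ∀ {v} → (∀ φ → ∅ ⊢ φ → Truths v φ) → Closed C (Truths v)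
  truths-closed {v} ⊨theorems φ d = let xs , xs-true , xs⊢φ = compact _ φ d in
    from-finite xs xs-true xs⊢φ
    where
    from-finite : ∀ xs {φ} → listSet xs ⊆ Truths v → listSet xs ⊢ φ → Truths v φ
    from-finite [] _ ⊢φ = ⊨theorems _ ⊢φ
    from-finite (x ∷ xs) xs-true xs⊢φ = modus-ponens
      (from-finite xs (λ ψ → xs-true ψ ∘ there) (deduction-∷ xs⊢φ)) (xs-true x (here refl))

  record Ideal (P : FSet {A}) : Set where
    field
      antitone : ⟦ x ⟧ ⊢ y → P y → P x
      ∨-closed : P x → P y → P (x ∨' y)
      nonempty : ∃ P

  Negated : FSet {A} → FSet {A}
  Negated P ψ = ∃ λ γ → P γ × ψ ≡ ¬' γ

  negated-ideal-⊢ : ∀ {P} → Ideal P → (Cn ∅ ∪ Negated P) ⊢ φ → P (¬' φ)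
  negated-ideal-⊢ {P = P} ideal d = let ys , ys⊆ , ys⊢φ = compact _ _ d in
    from-finite ys ys⊆ ys⊢φ
    where
    open Ideal ideal
    from-finite : ∀ ys {φ} → listSet ys ⊆ (Cn ∅ ∪ Negated P) → listSet ys ⊢ φ → P (¬' φ)
    from-finite [] {φ} _ ⊢φ = let z , z∈P = nonempty in
      antitone (⊢-taut₂ (φ ∷ z ∷ []) p₀ (¬' p₀) p₁ (theorem ⊢φ) (inclusion _ _ refl)) z∈P
    from-finite (y ∷ ys) {φ} ys⊆ ys⊢φ
      with ys⊆ y (here refl) | from-finite ys (λ ψ → ys⊆ ψ ∘ there) (deduction-∷ ys⊢φ)
    ... | inj₁ ⊢y | y⇒φ-refuted = antitone
      (⊢-taut₂ (y ∷ φ ∷ []) p₀ (¬' p₁) (¬' (p₀ ⇒ p₁)) (theorem ⊢y) (inclusion _ _ refl))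
      y⇒φ-refuted
    ... | inj₂ (γ , γ∈P , refl) | y⇒φ-refuted = antitone
      (taut⊢ (γ ∷ φ ∷ []) (¬' p₁) (¬' (¬' p₀ ⇒ p₁) ∨' p₀))
      (∨-closed y⇒φ-refuted γ∈P)

module Entrenchment {A : Set} (C : ConsRel {A}) (_≼_ : Form A → Form A → Set) where
  open ConsRel C
  open Consequence C

  private variable
    U V : FSet {A}
    α β γ δ x : Form A

  Incoherent : Form A → Form A → Set
  Incoherent α γ = (α ⇒ γ) ≼ (¬' α)

  ^⊆Coh⇒¬incoherent : (_^_ C _≼_ U α) ⊆ Coh C _≼_ α → U γ → ¬ Incoherent α γ
  ^⊆Coh⇒¬incoherent coh uγ = coh _ (_ , uγ , refl)

  ¬incoherent⇒^⊆Coh : (∀ {γ} → U γ → ¬ Incoherent α γ) → (_^_ C _≼_ U α) ⊆ Coh C _≼_ α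
  ¬incoherent⇒^⊆Coh free _ (_ , uγ , refl) = free uγ

  𝓑max-⊆ : 𝓑max C _≼_ α U → 𝓑 C _≼_ α V → U ⊆ V → V ⊆ U
  𝓑max-⊆ ((clU , _) , maximal) bV U⊆V γ vγ =
    closed-stable clU λ γ∉U → maximal _ bV U⊆V (γ , vγ , γ∉U)

  𝓑wmax-⊆ : 𝓑wmax C _≼_ α U → 𝓑w C _≼_ α V → U ⊆ V → V ⊆ U
  𝓑wmax-⊆ {α} ((clU , _) , maximal) bV U⊆V γ vγ = closed-stable clU λ γ∉U →
    maximal _ bV (λ { _ (β , uβ , e) → β , U⊆V β uβ , e })
      ((α ⇒ γ) , (γ , vγ , refl) , λ { (_ , uγ , refl) → γ∉U uγ })

  module _ (E : IsEntrenchment C _≼_) where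
    open IsEntrenchment E

    incoherent-¬-self : Incoherent α (¬' α)
    incoherent-¬-self {α} =
      dominance _ _ _ (taut⊢ (α ∷ []) (p₀ ⇒ ¬' p₀) (¬' p₀)) (refl≼ (¬' α))

    incoherent⇒∨≼ : Incoherent α x → (¬' α ∨' x) ≼ (¬' α)
    incoherent⇒∨≼ {α} {x} = dominance _ _ _ (taut⊢ (α ∷ x ∷ []) (¬' p₀ ∨' p₁) (p₀ ⇒ p₁))

    ∨≼⇒incoherent : (¬' α ∨' x) ≼ (¬' α) → Incoherent α x
    ∨≼⇒incoherent {α} {x} = dominance _ _ _ (taut⊢ (α ∷ x ∷ []) (p₀ ⇒ p₁) (¬' p₀ ∨' p₁))

    ≼-absorb : RightConjunction C _≼_ → ∀ {b c y} →
               y ≼ c → ⟦ c ∧' y ⟧ ⊢ b → ⟦ b ⟧ ⊢ (c ∧' y) → ⟦ b ∨' y ⟧ ⊢ y → (b ∨' y) ≼ b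
    ≼-absorb RC {b} {c} {y} y≼c c∧y⊢b b⊢c∧y b∨y⊢y = dominance _ y b b∨y⊢y
      (proj₁ (rightEquiv (c ∧' y) b y c∧y⊢b b⊢c∧y) (RC c y y y≼c (refl≼ y)))

    complete-absorbs : (∀ γ → U γ ⊎ U (¬' γ)) → 𝓑w C _≼_ α V →
                       (_^_ C _≼_ U α) ⊆ (_^_ C _≼_ V α) → V ⊆ U
    complete-absorbs {α = α} complete (clV , cohV) U^⊆V^ γ vγ with complete γ
    ... | inj₁ uγ = uγ
    ... | inj₂ u¬γ with U^⊆V^ _ (¬' γ , u¬γ , refl)
    ...   | _ , v¬γ , refl = contradiction incoherent-¬-self (^⊆Coh⇒¬incoherent cohV (clV _
            (⊢-taut₂ (γ ∷ α ∷ []) p₀ (¬' p₀) (¬' p₁) (inclusion _ _ vγ) (inclusion _ _ v¬γ))))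

    complete-𝓑wmax : 𝓑w C _≼_ α U → (∀ γ → U γ ⊎ U (¬' γ)) → 𝓑wmax C _≼_ α U
    complete-𝓑wmax bU complete = bU , λ V bV U^⊆V^ → λ { (_ , (γ , vγ , refl) , γ∉U) →
      γ∉U (γ , complete-absorbs complete bV U^⊆V^ γ vγ , refl) }

    module _ (W : WeakLeftDisjunction C _≼_) where

      incoherent-ideal : Ideal (Incoherent α)
      incoherent-ideal {α} = record
        { antitone = dominance _ _ _ ∘ ⇒-monotone
        ; ∨-closed = λ {x} {y} x-inc y-inc →
            ∨≼⇒incoherent (W (¬' α) x y (incoherent⇒∨≼ x-inc) (incoherent⇒∨≼ y-inc))
        ; nonempty = ¬' α , incoherent-¬-self
        }

      incoherent⇒|~w : Incoherent α (¬' β) → _|~w_ C _≼_ α β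
      incoherent⇒|~w {α} {β} ¬β-inc U max@((clU , cohU) , _) =
        𝓑wmax-⊆ max (Cn-closed , ¬incoherent⇒^⊆Coh coherent) (λ γ → inclusion _ γ ∘ inj₁)
          β (inclusion _ β (inj₂ refl))
        where
        open Ideal incoherent-ideal
        coherent : Cn (U ∪⟦ β ⟧) γ → ¬ Incoherent α γ
        coherent {γ} U,β⊢γ γ-inc = ^⊆Coh⇒¬incoherent cohU (clU _ (deduction U β γ U,β⊢γ))
          (antitone (taut⊢ (β ∷ γ ∷ []) (p₀ ⇒ p₁) (¬' p₀ ∨' p₁)) (∨-closed ¬β-inc γ-inc))

      truths-𝓑wmax : ∀ {v} → (∀ ψ → (Cn ∅ ∪ Negated (Incoherent α)) ψ → Truths v ψ) →
                     𝓑wmax C _≼_ α (Truths v)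
      truths-𝓑wmax {v = v} ⊨premises = complete-𝓑wmax
        ( truths-closed (λ φ → ⊨premises φ ∘ inj₁)
        , ¬incoherent⇒^⊆Coh λ {γ} γ-true γ-inc →
            truths-consistent v γ γ-true (⊨premises (¬' γ) (inj₂ (γ , γ-inc , refl))))
        (truths-complete v)

      |~w⇒incoherent : _|~w_ C _≼_ α β → Incoherent α (¬' β)
      |~w⇒incoherent {α} {β} α|~wβ = negated-ideal-⊢ incoherent-ideal
        (supraclassical _ β λ v ⊨premises → α|~wβ (Truths v) (truths-𝓑wmax ⊨premises))

      module _ (T : Transitivity C _≼_) (RC : RightConjunction C _≼_) where

        -- f splits into the cases y₁ and y₂, and b = f ∧ ¬α is equivalent to ¬α ∧ yᵢ for
        -- both; so Right Conjunction puts each yᵢ below b, then Weak Left Disjunction puts f there.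
        ⇒-≼-¬ : δ ≼ (¬' α) → Incoherent α (¬' β) → ((α ⇒ β) ⇒ δ) ≼ (¬' α)
        ⇒-≼-¬ {δ} {α} {β} δ≼¬α ¬β-inc =
          T f b (¬' α) f≼b (dominance _ _ _ (taut⊢ σ B (¬' p₀)) (refl≼ (¬' α)))
          where
          σ : Vec (Form A) 3
          σ = α ∷ β ∷ δ ∷ []
          F B Y₁ Y₂ : Schema 3
          F = (p₀ ⇒ p₁) ⇒ p₂
          B = F ∧' ¬' p₀
          Y₁ = F ∧' (p₀ ⇒ p₁)
          Y₂ = F ∧' (p₀ ⇒ ¬' p₁)
          f b y₁ y₂ : Form A
          f = F [ σ ]
          b = B [ σ ]
          y₁ = Y₁ [ σ ]
          y₂ = Y₂ [ σ ]
          b∨y₁≼b : (b ∨' y₁) ≼ b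
          b∨y₁≼b = ≼-absorb RC (dominance _ _ _ (taut⊢ σ Y₁ p₂) δ≼¬α)
            (taut⊢ σ (¬' p₀ ∧' Y₁) B) (taut⊢ σ B (¬' p₀ ∧' Y₁)) (taut⊢ σ (B ∨' Y₁) Y₁)
          b∨y₂≼b : (b ∨' y₂) ≼ b
          b∨y₂≼b = ≼-absorb RC (dominance _ _ _ (taut⊢ σ Y₂ (p₀ ⇒ ¬' p₁)) ¬β-inc)
            (taut⊢ σ (¬' p₀ ∧' Y₂) B) (taut⊢ σ B (¬' p₀ ∧' Y₂)) (taut⊢ σ (B ∨' Y₂) Y₂)
          f≼b : f ≼ b
          f≼b = dominance _ _ _ (taut⊢ σ F (B ∨' Y₁ ∨' Y₂)) (W b y₁ y₂ b∨y₁≼b b∨y₂≼b)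

        incoherent⇒|~ : Incoherent α (¬' β) → _|~_ C _≼_ α β
        incoherent⇒|~ {α} {β} ¬β-inc U max@((clU , cohU) , _) = deduction⁻ U α β
          (inclusion U (α ⇒ β) (𝓑max-⊆ max (Cn-closed , coherent) (λ γ → inclusion _ γ ∘ inj₁)
            (α ⇒ β) (inclusion _ _ (inj₂ refl))))
          where
          coherent : Cn (U ∪⟦ α ⇒ β ⟧) ⊆ Coh C _≼_ α
          coherent δ U,α⇒β⊢δ δ≼¬α =
            cohU _ (clU _ (deduction U (α ⇒ β) δ U,α⇒β⊢δ)) (⇒-≼-¬ δ≼¬α ¬β-inc)

mainTheorem6 : {Atom : Set} (C : ConsRel {Atom})
    (_≼_ : Form Atom → Form Atom → Set) →
    IsEntrenchment C _≼_ → WeakLeftDisjunction C _≼_ →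
    ((∀ α β → (((¬' α) ∨' (¬' β)) ≼ (¬' α) → _|~w_ C _≼_ α β)
            × (_|~w_ C _≼_ α β → ((¬' α) ∨' (¬' β)) ≼ (¬' α)))
     × (Transitivity C _≼_ → RightConjunction C _≼_ →
        ∀ α β → ((¬' α) ∨' (¬' β)) ≼ (¬' α) → _|~_ C _≼_ α β))
mainTheorem6 C _≼_ E W =
  (λ α β → incoherent⇒|~w E W ∘ ∨≼⇒incoherent E , incoherent⇒∨≼ E ∘ |~w⇒incoherent E W)
  , λ T RC α β → incoherent⇒|~ E W T RC ∘ ∨≼⇒incoherent E
  where open Entrenchment C _≼_
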